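{- Let $m,n\ge 0$ and $\mathfrak{u},\mathfrak{v}\in\mathsf{W}(m,n)$. The join of $\mathfrak{u}$ and $\mathfrak{v}$ in $\mathbf{W}(m,n)$ is the word $\mathfrak{w}=w_1\cdots w_n$ with $w_i=\max\{u_i,v_i\}$ for all $i$ (in particular this word lies in $\mathsf{W}(m,n)$).
   Context: An $(m,n)$-word is a word $\mathfrak{w}=w_1w_2\cdots w_n$ of length $n$ over the alphabet $\{0,1,\dots,m+1\}$ such that (MN1) $w_1\neq m+1$, and (MN2) for every $s$ with $1\le s\le m$ and every index $i$, if $w_i=s$ then $w_j\ge s$ for all $j<i$. $\mathsf{W}(m,n)$ is the set of $(m,n)$-words and $\mathbf{W}(m,n)$ is $\mathsf{W}(m,n)$ ordered componentwise ($\mathfrak{u}\le\mathfrak{v}$ iff $u_i\le v_i$ for all $i$). -}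

module Defs where

open import Data.Nat using (ℕ; zero; suc; _≤_; _≥_; _<_; _⊔_)
open import Data.Fin using (Fin; toℕ)
open import Data.Product using (_×_; Σ)
open import Relation.Binary.PropositionalEquality using (_≡_; _≢_)

-- A word of length n over ℕ, letters indexed 1..n by Fin n (index i ↔ position toℕ i + 1).
Word : ℕ → Set
Word n = Fin n → ℕ

record IsMNWord (m n : ℕ) (w : Word n) : Set where
  field
    alphabet : ∀ i → w i ≤ suc m
    mn1      : ∀ i → toℕ i ≡ 0 → w i ≢ suc m
    mn2      : ∀ (s : ℕ) → 1 ≤ s → s ≤ m → ∀ i → w i ≡ s →
               ∀ j → toℕ j < toℕ i → w j ≥ s

MNWord : ℕ → ℕ → Set
MNWord m n = Σ (Word n) (IsMNWord m n)

_≤W_ : ∀ {m n} → MNWord m n → MNWord m n → Set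
u ≤W v = ∀ i → Σ.proj₁ u i ≤ Σ.proj₁ v i

IsJoin : ∀ {m n} → MNWord m n → MNWord m n → MNWord m n → Set
IsJoin {m} {n} u v j =
  (u ≤W j × v ≤W j) × (∀ (z : MNWord m n) → u ≤W z → v ≤W z → j ≤W z)

maxWord : ∀ {n} → Word n → Word n → Word n
maxWord u v i = u i ⊔ v i

-- Every letter of the pointwise maximum is the letter of u or of v at the same position.
-- Each condition on an (m,n)-word constrains a letter only by an upper bound, or by a
-- hypothesis on the letter at position i together with lower bounds on earlier letters;
-- both transfer from the word supplying position i to the maximum.
module Submission where

open import Defs
open import Data.Nat using (ℕ; suc; _⊔_; _≤_; _≥_; _<_)
open import Data.Fin using (toℕ)
open import Data.Nat.Properties using (⊔-sel; m≤m⊔n; m≤n⊔m; ⊔-lub; ≤-trans)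
open import Data.Sum using (inj₁; inj₂)
open import Data.Product using (Σ; _,_; proj₁)
open import Relation.Binary.PropositionalEquality using (_≡_; _≢_; trans; sym)

maxWord-isMNWord : ∀ {m n} {u v : Word n} →
  IsMNWord m n u → IsMNWord m n v → IsMNWord m n (maxWord u v)
maxWord-isMNWord {m} {u = u} {v} pu pv = record
  { alphabet = λ i → ⊔-lub (U.alphabet i) (V.alphabet i)
  ; mn1      = mn1
  ; mn2      = mn2
  }
  where
  module U = IsMNWord pu
  module V = IsMNWord pv

  mn1 : ∀ i → toℕ i ≡ 0 → maxWord u v i ≢ suc m
  mn1 i first eq with ⊔-sel (u i) (v i)
  ... | inj₁ max≡u = U.mn1 i first (trans (sym max≡u) eq)
  ... | inj₂ max≡v = V.mn1 i first (trans (sym max≡v) eq)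

  mn2 : ∀ s → 1 ≤ s → s ≤ m → ∀ i → maxWord u v i ≡ s →
        ∀ j → toℕ j < toℕ i → maxWord u v j ≥ s
  mn2 s 1≤s s≤m i eq j j<i with ⊔-sel (u i) (v i)
  ... | inj₁ max≡u = ≤-trans (U.mn2 s 1≤s s≤m i (trans (sym max≡u) eq) j j<i) (m≤m⊔n (u j) (v j))
  ... | inj₂ max≡v = ≤-trans (V.mn2 s 1≤s s≤m i (trans (sym max≡v) eq) j j<i) (m≤n⊔m (u j) (v j))

maxWord-isJoin : ∀ {m n} (u v : MNWord m n) (p : IsMNWord m n (maxWord (proj₁ u) (proj₁ v))) →
  IsJoin u v (maxWord (proj₁ u) (proj₁ v) , p)
maxWord-isJoin (u , _) (v , _) _ =
  ((λ i → m≤m⊔n (u i) (v i)) , (λ i → m≤n⊔m (u i) (v i))) ,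
  λ _ u≤z v≤z i → ⊔-lub (u≤z i) (v≤z i)

lemma5p2 : (m n : ℕ) (u v : MNWord m n) →
    Σ (IsMNWord m n (maxWord (proj₁ u) (proj₁ v)))
      (λ p → IsJoin u v (maxWord (proj₁ u) (proj₁ v) , p))
lemma5p2 m n (u , pu) (v , pv) = p , maxWord-isJoin (u , pu) (v , pv) p
  where
  p : IsMNWord m n (maxWord u v)
  p = maxWord-isMNWord pu pv
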